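{- Let $M=(X,R,D,\theta)$ be a bimodal Kripke model, $k<\omega$, and suppose every substitution instance of $\chi_k$ is true at every point of $M$. Let $\Gamma$ be a finite set of bimodal formulas closed under subformulas. Then for every finite set of formulas $\Psi\supseteq\Gamma$ and every $\Gamma$-filtration $\widehat{M}=(X/{\sim_\Psi},\widehat{R},\widehat{D},\widehat{\theta})$ of $M$, we have $\chi(X/{\sim_\Psi},\widehat{R})>k$.
   Context: Bimodal formulas use modalities $\lozenge$ (interpreted by $R$) and $\langle\neq\rangle$ (interpreted by $D$); $\exists\varphi:=\langle\neq\rangle\varphi\vee\varphi$, $\forall\varphi:=[\neq]\varphi\wedge\varphi$. $\chi_k$ is the formula $\forall \bigvee_{i<k}(p_i\wedge\bigwedge_{i\neq j<k}\neg p_j)\to \exists\bigvee_{i<k}(p_i\wedge\lozenge p_i)$; a substitution instance is the result of uniformly replacing variables by bimodal formulas. For a set of formulas $\Psi$, $x\sim_\Psi y$ iff $x,y$ satisfy the same formulas of $\Psi$ in $M$. For a subformula-closed $\Gamma$, a $\Gamma$-filtration of $M=(X,R_0,R_1,\theta)$ is a model $(X/{\sim},\widehat{R}_0,\widehat{R}_1,\widehat{\theta})$ where $\sim$ is an equivalence with $\sim\subseteq\sim_\Gamma$, $[x]\in\widehat\theta(p)$ iff $x\in\theta(p)$ for variables $p\in\Gamma$, and for each $i$, $(R_i)_\sim\subseteq\widehat R_i\subseteq (R_i)^\Gamma_\sim$, where $[x](R_i)_\sim[y]$ iff $x'R_iy'$ for some $x'\sim x$, $y'\sim y$, and $[x](R_i)^\Gamma_\sim[y]$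 iff for every $\lozenge_i\psi\in\Gamma$, $M,y\models\psi$ implies $M,x\models\lozenge_i\psi$. For $S\subseteq Y\times Y$, a partition of $Y$ is proper if no block contains $x,y$ with $xSy$, and $\chi(Y,S)$ is the least size of a finite proper partition of $Y$ ($\infty$ if none). -}

module Defs where

open import Data.Nat using (ℕ; _≤_; _≟_)
open import Data.Fin using (Fin)
open import Data.List using (List; []; _∷_; map; filter; upTo; foldr)
open import Data.List.Membership.Propositional using (_∈_)
open import Data.Product using (Σ; _×_; _,_; ∃)
open import Data.Empty using (⊥)
open import Relation.Nullary using (¬_; ¬?)
open import Relation.Binary.PropositionalEquality using (_≡_; _≢_)

infixr 6 _∧'_
data Fm : Set where
  var  : ℕ → Fm
  ⊥'   : Fm
  ¬'_  : Fm → Fm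
  _∧'_ : Fm → Fm → Fm
  ◇_   : Fm → Fm
  ⟨≠⟩_ : Fm → Fm

⊤' : Fm
⊤' = ¬' ⊥'

_∨'_ : Fm → Fm → Fm
a ∨' b = ¬' ((¬' a) ∧' (¬' b))

_⇒'_ : Fm → Fm → Fm
a ⇒' b = ¬' (a ∧' (¬' b))

[≠]_ : Fm → Fm
[≠] a = ¬' (⟨≠⟩ (¬' a))

∃' : Fm → Fm
∃' a = (⟨≠⟩ a) ∨' a

∀' : Fm → Fm
∀' a = ([≠] a) ∧' a

⋁ : List Fm → Fm
⋁ []       = ⊥'
⋁ (a ∷ as) = a ∨' ⋁ as

⋀ : List Fm → Fm
⋀ []       = ⊤'
⋀ (a ∷ as) = a ∧' ⋀ as

only : ℕ → ℕ → Fm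
only k i = var i ∧' ⋀ (map (λ j → ¬' var j) (filter (λ j → ¬? (j ≟ i)) (upTo k)))

χ : ℕ → Fm
χ k = (∀' (⋁ (map (only k) (upTo k)))) ⇒' (∃' (⋁ (map (λ i → var i ∧' (◇ var i)) (upTo k))))

subst : (ℕ → Fm) → Fm → Fm
subst σ (var p)  = σ p
subst σ ⊥'       = ⊥'
subst σ (¬' a)   = ¬' subst σ a
subst σ (a ∧' b) = subst σ a ∧' subst σ b
subst σ (◇ a)    = ◇ subst σ a
subst σ (⟨≠⟩ a)  = ⟨≠⟩ subst σ a

data ImmSub : Fm → Fm → Set where
  sub¬  : ∀ {a}   → ImmSub a (¬' a)
  sub∧l : ∀ {a b} → ImmSub a (a ∧' b)
  sub∧r : ∀ {a b} → ImmSub b (a ∧' b)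
  sub◇  : ∀ {a}   → ImmSub a (◇ a)
  sub≠  : ∀ {a}   → ImmSub a (⟨≠⟩ a)

SubClosed : List Fm → Set
SubClosed Γ = ∀ {ψ φ} → φ ∈ Γ → ImmSub ψ φ → ψ ∈ Γ

_⊆_ : List Fm → List Fm → Set
Γ ⊆ Ψ = ∀ {φ} → φ ∈ Γ → φ ∈ Ψ

record Model : Set₁ where
  field
    X  : Set
    R  : X → X → Set
    D  : X → X → Set
    θ  : ℕ → X → Set
    pt : X

module _ (M : Model) where
  open Model M

  _⊨_ : X → Fm → Set
  x ⊨ var p    = θ p x
  x ⊨ ⊥'       = ⊥
  x ⊨ (¬' a)   = ¬ (x ⊨ a)
  x ⊨ (a ∧' b) = (x ⊨ a) × (x ⊨ b)
  x ⊨ (◇ a)    = Σ X λ y → R x y × (y ⊨ a)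
  x ⊨ (⟨≠⟩ a)  = Σ X λ y → D x y × (y ⊨ a)

  _⇔_ : Set → Set → Set
  A ⇔ B = (A → B) × (B → A)

  Equiv : List Fm → X → X → Set
  Equiv Ψ x y = ∀ {φ} → φ ∈ Ψ → (x ⊨ φ) ⇔ (y ⊨ φ)

  -- A quotient X/E presented as a type Q with a surjection whose kernel is E
  record Quotient (E : X → X → Set) : Set₁ where
    field
      Q    : Set
      π    : X → Q
      surj : ∀ q → ∃ λ x → π x ≡ q
      ker  : ∀ x y → (π x ≡ π y) ⇔ E x y

  record IsFiltration (Γ : List Fm) {E : X → X → Set} (q : Quotient E)
      (R̂ D̂ : Quotient.Q q → Quotient.Q q → Set) (θ̂ : ℕ → Quotient.Q q → Set) : Set where
    open Quotient q
    field
      ∼⊆∼Γ : ∀ x y → E x y → Equiv Γ x y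
      val  : ∀ p x → var p ∈ Γ → θ̂ p (π x) ⇔ θ p x
      R-min : ∀ x y → R x y → R̂ (π x) (π y)
      R-max : ∀ x y → R̂ (π x) (π y) → ∀ ψ → (◇ ψ) ∈ Γ → y ⊨ ψ → x ⊨ (◇ ψ)
      D-min : ∀ x y → D x y → D̂ (π x) (π y)
      D-max : ∀ x y → D̂ (π x) (π y) → ∀ ψ → (⟨≠⟩ ψ) ∈ Γ → y ⊨ ψ → x ⊨ (⟨≠⟩ ψ)

record Partition (Y : Set) (m : ℕ) : Set where
  field
    block    : Y → Fin m
    nonempty : ∀ i → ∃ λ y → block y ≡ i

Proper : {Y : Set} {m : ℕ} → (Y → Y → Set) → Partition Y m → Set
Proper S P = ∀ x y → S x y → Partition.block P x ≢ Partition.block P y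

χ> : (Y : Set) → (Y → Y → Set) → ℕ → Set
χ> Y S k = ∀ m → m ≤ k → (P : Partition Y m) → ¬ Proper S P

-- A proper partition of X/∼Ψ into m ≤ k blocks pulls back along the quotient map to a
-- colouring of X by k colours in which R never joins two points of the same colour, since
-- the filtration contains R. Each colour class is a union of ∼Ψ-classes, and Ψ is finite, so
-- it is defined by a Boolean combination of formulas of Ψ. Substituting these definitions
-- for p₀, …, p_{k-1} makes the antecedent of χ_k true everywhere and its consequent false,
-- contradicting the validity of that instance of χ_k.
module Submission where

open import Defs
open import Data.Nat using (ℕ; _<_; _≟_; _<?_)
open import Data.Nat.Properties using (<-≤-trans; m<n⇒m<1+n; n<1+n; m<1+n⇒m<n∨m≡n)
open import Data.List using (List; []; _∷_; map; filter; upTo)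
open import Data.List.Relation.Unary.Any using (here; there)
open import Data.List.Membership.Propositional using (_∈_)
open import Data.List.Membership.Propositional.Properties
  using (∈-upTo⁺; ∈-upTo⁻; ∈-map⁺; ∈-map⁻; ∈-filter⁻)
open import Data.Fin using (toℕ)
open import Data.Fin.Properties using (toℕ-injective; toℕ<n)
open import Data.Product using (Σ; _×_; _,_; proj₁; proj₂)
import Data.Product as Product
open import Data.Sum using ([_,_]′)
open import Effect.Monad using (RawMonad)
open import Level using (0ℓ)
open import Function using (const; _∘′_)
open import Relation.Nullary using (¬_; ¬?; yes; no)
open import Relation.Nullary.Negation using (¬¬-Monad; contradiction; Stable)
open import Relation.Nullary.Decidable using (¬¬-excluded-middle; decidable-stable)
open import Relation.Binary.PropositionalEquality using (_≡_; _≢_; refl; sym; trans; cong)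

open RawMonad (¬¬-Monad {0ℓ})

¬¬-∀< : ∀ k {P : ℕ → Set} → (∀ n → n < k → ¬ ¬ P n) → ¬ ¬ (∀ n → n < k → P n)
¬¬-∀< ℕ.zero    f = pure λ _ ()
¬¬-∀< (ℕ.suc k) f = do
  below ← ¬¬-∀< k (λ n n<k → f n (m<n⇒m<1+n n<k))
  last  ← f k (n<1+n k)
  pure λ n n<1+k → [ below n , (λ { refl → last }) ]′ (m<1+n⇒m<n∨m≡n n<1+k)

choose< : {A : Set} {S : ℕ → A → Set} → A → ∀ k →
          (∀ n → n < k → Σ A (S n)) → Σ (ℕ → A) λ f → ∀ n → n < k → S n (f n)
choose< {A} {S} default k h = (λ n → proj₁ (pick n)) , (λ n → proj₂ (pick n))
  where
  pick : ∀ n → Σ A λ a → n < k → S n a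
  pick n with n <? k
  ... | yes n<k = Product.map₂ const (h n n<k)
  ... | no  n≮k = default , λ n<k → contradiction n<k n≮k

module _ (N : Model) where
  open Model N

  private
    infix 4 _⊩_
    _⊩_ : X → Fm → Set
    _⊩_ = _⊨_ N

  ⊩⋁ : ∀ {L a x} → a ∈ L → x ⊩ a → x ⊩ ⋁ L
  ⊩⋁ (here refl) xa (¬a , _)  = ¬a xa
  ⊩⋁ (there a∈L) xa (_ , ¬⋁) = ¬⋁ (⊩⋁ a∈L xa)

  ⊮⋁ : ∀ L {x} → (∀ {a} → a ∈ L → ¬ x ⊩ a) → ¬ x ⊩ ⋁ L
  ⊮⋁ []      f ()
  ⊮⋁ (a ∷ L) f x⋁ = x⋁ (f (here refl) , ⊮⋁ L (λ b∈L → f (there b∈L)))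

  ⊩⋀ : ∀ L {x} → (∀ {a} → a ∈ L → x ⊩ a) → x ⊩ ⋀ L
  ⊩⋀ []      f ()
  ⊩⋀ (a ∷ L) f = f (here refl) , ⊩⋀ L (λ b∈L → f (there b∈L))

  ⊩∀' : ∀ φ {x} → (∀ y → y ⊩ φ) → x ⊩ ∀' φ
  ⊩∀' φ {x} all = (λ { (y , _ , ¬φ) → ¬φ (all y) }) , all x

  ⊮∃' : ∀ φ {x} → (∀ y → ¬ y ⊩ φ) → ¬ x ⊩ ∃' φ
  ⊮∃' φ {x} none x∃ = x∃ ((λ { (y , _ , φ) → none y φ }) , none x)

  Equiv-refl : ∀ {Ψ x} → Equiv N Ψ x x
  Equiv-refl _ = (λ a → a) , (λ a → a)

  Equiv-trans : ∀ {Ψ x y z} → Equiv N Ψ x y → Equiv N Ψ y z → Equiv N Ψ x z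
  Equiv-trans e f φ∈Ψ = (λ a → proj₁ (f φ∈Ψ) (proj₁ (e φ∈Ψ) a))
                      , (λ a → proj₂ (e φ∈Ψ) (proj₂ (f φ∈Ψ) a))

  Equiv-∷ : ∀ {φ Ψ x y} → Equiv N Ψ x y → (x ⊩ φ → y ⊩ φ) × (y ⊩ φ → x ⊩ φ) →
            Equiv N (φ ∷ Ψ) x y
  Equiv-∷ e h (here refl) = h
  Equiv-∷ e h (there φ∈Ψ) = e φ∈Ψ

  Defines : Fm → (X → Set) → Set
  Defines B P = ∀ x → (x ⊩ B → P x) × (P x → x ⊩ B)

  -- Only under double negation: the case split on the truth of each formula is classical.
  definable : ∀ Ψ {P : X → Set} → (∀ x → Stable (P x)) →
              (∀ {x y} → Equiv N Ψ x y → P x → P y) → ¬ ¬ Σ Fm λ B → Defines B P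
  definable [] {P} _ inv = do
    yes p ← ¬¬-excluded-middle {A = P pt}
      where no ¬p → pure (⊥' , λ x → (λ ()) , λ px → contradiction (inv (λ ()) px) ¬p)
    pure (⊤' , λ x → (λ _ → inv (λ ()) p) , λ _ ())
  definable (φ ∷ Ψ) {P} stable inv = do
    B⁺ , defines⁺ ← definable Ψ (restrict-stable (_⊩ φ)) (restrict-inv (_⊩ φ))
    B⁻ , defines⁻ ← definable Ψ (restrict-stable (λ y → ¬ y ⊩ φ)) (restrict-inv (λ y → ¬ y ⊩ φ))
    pure ((φ ∧' B⁺) ∨' ((¬' φ) ∧' B⁻) , λ x →
      (λ xB → stable x λ ¬px → xB
        ( (λ { (φx , xB⁺) → ¬px (proj₁ (defines⁺ x) xB⁺ x Equiv-refl φx) })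
        , (λ { (¬φx , xB⁻) → ¬px (proj₁ (defines⁻ x) xB⁻ x Equiv-refl ¬φx) }) ))
      , (λ px (¬case⁺ , ¬case⁻) → ¬¬-excluded-middle λ
          { (yes φx) → ¬case⁺ (φx , proj₂ (defines⁺ x) λ y e φy →
              inv (Equiv-∷ e (const φy , const φx)) px)
          ; (no ¬φx) → ¬case⁻ (¬φx , proj₂ (defines⁻ x) λ y e ¬φy →
              inv (Equiv-∷ e ((λ φx → contradiction φx ¬φx) , (λ φy → contradiction φy ¬φy))) px) }))
    where
    restrict : (X → Set) → X → Set
    restrict C x = ∀ y → Equiv N Ψ x y → C y → P y
    restrict-stable : ∀ C x → Stable (restrict C x)
    restrict-stable C x ¬¬r y e cy = stable y λ ¬py → ¬¬r λ r → ¬py (r y e cy)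
    restrict-inv : ∀ C {x x′} → Equiv N Ψ x x′ → restrict C x → restrict C x′
    restrict-inv C e r y e′ = r y (Equiv-trans e e′)

  ColourValuation : ℕ → (X → ℕ) → Set
  ColourValuation k c = ∀ n → n < k → ∀ x → (θ n x → c x ≡ n) × (c x ≡ n → θ n x)

  proper-colouring⇒⊮χ : ∀ k (c : X → ℕ) → (∀ x → c x < k) → ColourValuation k c →
                        (∀ {x y} → R x y → c x ≢ c y) → ∀ x → ¬ x ⊩ χ k
  proper-colouring⇒⊮χ k c c<k valuation proper x xχ =
    xχ (⊩∀' partitioned colour-unique , ⊮∃' repeated λ y → ⊮⋁ _ (no-repeat y))
    where
    partitioned repeated : Fm
    partitioned = ⋁ (map (only k) (upTo k))
    repeated    = ⋁ (map (λ i → var i ∧' (◇ var i)) (upTo k))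

    colour-of : ∀ {n y} → n < k → y ⊩ var n → c y ≡ n
    colour-of n<k yn = proj₁ (valuation _ n<k _) yn

    colour-unique : ∀ y → y ⊩ partitioned
    colour-unique y = ⊩⋁ (∈-map⁺ (only k) (∈-upTo⁺ (c<k y)))
      (proj₂ (valuation _ (c<k y) y) refl , ⊩⋀ _ other-colours)
      where
      other-colours : ∀ {a} → a ∈ map (λ j → ¬' var j) (filter (λ j → ¬? (j ≟ c y)) (upTo k)) →
                      y ⊩ a
      other-colours a∈ with ∈-map⁻ (λ j → ¬' var j) a∈
      ... | j , j∈ , refl with ∈-filter⁻ (λ j → ¬? (j ≟ c y)) j∈
      ... | j<k , j≢cy = λ yj → j≢cy (sym (colour-of (∈-upTo⁻ j<k) yj))

    no-repeat : ∀ y {a} → a ∈ map (λ i → var i ∧' (◇ var i)) (upTo k) → ¬ y ⊩ a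
    no-repeat y a∈ ya with ∈-map⁻ (λ i → var i ∧' (◇ var i)) a∈
    no-repeat y a∈ (yi , z , yRz , zi) | i , i<k , refl =
      proper yRz (trans (colour-of (∈-upTo⁻ i<k) yi) (sym (colour-of (∈-upTo⁻ i<k) zi)))

substModel : Model → (ℕ → Fm) → Model
substModel M σ = record M { θ = λ p x → _⊨_ M x (σ p) }

subst-sound : ∀ M σ φ x → (_⊨_ M x (subst σ φ) → _⊨_ (substModel M σ) x φ)
                        × (_⊨_ (substModel M σ) x φ → _⊨_ M x (subst σ φ))
subst-sound M σ (var p)  x = (λ a → a) , (λ a → a)
subst-sound M σ ⊥'       x = (λ a → a) , (λ a → a)
subst-sound M σ (¬' φ)   x = (λ ¬a a → ¬a (proj₂ (subst-sound M σ φ x) a))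
                           , (λ ¬a a → ¬a (proj₁ (subst-sound M σ φ x) a))
subst-sound M σ (φ ∧' ψ) x = Product.map (proj₁ (subst-sound M σ φ x)) (proj₁ (subst-sound M σ ψ x))
                           , Product.map (proj₂ (subst-sound M σ φ x)) (proj₂ (subst-sound M σ ψ x))
subst-sound M σ (◇ φ)    x = (λ { (y , r , a) → y , r , proj₁ (subst-sound M σ φ y) a })
                           , (λ { (y , r , a) → y , r , proj₂ (subst-sound M σ φ y) a })
subst-sound M σ (⟨≠⟩ φ)  x = (λ { (y , d , a) → y , d , proj₁ (subst-sound M σ φ y) a })
                           , (λ { (y , d , a) → y , d , proj₂ (subst-sound M σ φ y) a })

lemma1 : (M : Model) (k : ℕ)
    → (∀ (σ : ℕ → Fm) (x : Model.X M) → _⊨_ M x (subst σ (χ k)))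
    → (Γ : List Fm) → SubClosed Γ
    → (Ψ : List Fm) → Γ ⊆ Ψ
    → (q : Quotient M (Equiv M Ψ))
    → (R̂ D̂ : Quotient.Q q → Quotient.Q q → Set) (θ̂ : ℕ → Quotient.Q q → Set)
    → IsFiltration M Γ q R̂ D̂ θ̂
    → χ> (Quotient.Q q) R̂ k
lemma1 M k χ-valid Γ _ Ψ _ q R̂ D̂ θ̂ filtration m m≤k P proper =
  ¬¬-∀< k (λ n _ → definable M Ψ (λ x → decidable-stable (colour x ≟ n)) (colour-inv n))
    λ classes → let σ , σ-defines = choose< ⊥' k classes in
      proper-colouring⇒⊮χ (substModel M σ) k colour colour<k σ-defines proper-colour pt
        (proj₁ (subst-sound M σ (χ k) pt) (χ-valid σ pt))
  where
  open Model M
  open Quotient q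
  open IsFiltration filtration

  colour : X → ℕ
  colour x = toℕ (Partition.block P (π x))

  colour<k : ∀ x → colour x < k
  colour<k x = <-≤-trans (toℕ<n _) m≤k

  colour-inv : ∀ n {x y} → Equiv M Ψ x y → colour x ≡ n → colour y ≡ n
  colour-inv n {x} {y} e = trans (cong (λ z → toℕ (Partition.block P z)) (sym (proj₂ (ker x y) e)))

  proper-colour : ∀ {x y} → R x y → colour x ≢ colour y
  proper-colour {x} {y} xRy = proper (π x) (π y) (R-min x y xRy) ∘′ toℕ-injective
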